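{- For $i\in[\![0,f-1]\!]$: (i) $\alpha_i+\alpha'_{i+f}>\nu$ if and only if $X_i=\mathbf{0}$; (ii) $\alpha'_i+\alpha_{i+f}>\nu$ if and only if $X_{i+f}=\mathbf{0}$.
   Context: Let $p$ be a prime, $f\ge2$, $q=p^f$, $e=p^f-1$, $\nu=p+\dots+p^{f-1}$. Let $h$ be an integer not divisible by $q+1$, $\gamma'\in\mathbb{Z}/e\mathbb{Z}$. Let $h_0,\dots,h_{f-1}\in[\![0,p-1]\!]$ with $h\equiv1+\sum_{i=0}^{f-1}h_ip^{f-1-i}\pmod{q+1}$, $h_i=p-1-h_{i-f}$ for $f\le i<2f$, extended $2f$-periodically; $\varepsilon_i=1$ if $h_i=p-1$, else $0$. Let $\alpha_i\in[\![0,e-1]\!]$ with $\alpha_i\equiv\lfloor p^ih/(q+1)\rfloor-p^i\gamma'\pmod e$ (extended $2f$-periodically to $\mathbb{Z}$), and let $\alpha'_i\in[\![0,e-1]\!]$ be defined by $\alpha'_i+\alpha_{i+f}\equiv\nu\pmod e$. Define $X_i=\mathbf{A}$ if $0\le\alpha_i<\nu/p+\varepsilon_{i+f}$; $\mathbf{AB}$ if $\nu/p+\varepsilon_{i+f}\le\alpha_i\le\frac{p-1}{p}\nu-\varepsilon_i$; $\mathbf{B}$ if $\frac{p-1}{p}\nu-\varepsilon_i<\alpha_i\le\nu$; $\mathbf{0}$ if $\nu<\alpha_i<e$. -}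

module Defs where

open import Data.Nat as ℕ using (ℕ; zero; suc; _+_; _*_; _∸_; _^_; _≤_; _<_; _≤?_; _<?_; _≟_)
open import Data.Integer as ℤ using (ℤ; +_; _/ℕ_; _%ℕ_)
open import Data.Integer.Divisibility as ℤD using ()
open import Data.Fin using (Fin; toℕ; fromℕ<)
open import Data.List using (List; map; upTo; allFin)
open import Data.Nat.ListAction using (sum)
open import Relation.Nullary using (yes; no)

-- natural-number remainder, total (value irrelevant for modulus 0,
-- which never occurs in this setting since p ≥ 2, f ≥ 2)
_mod'_ : ℕ → ℕ → ℕ
n mod' zero = 0
n mod' suc k = n ℕ.% suc k

-- integer reduction into [0, m-1] (total; m > 0 in this setting)
_modℤ'_ : ℤ → ℕ → ℕ
x modℤ' zero = 0
x modℤ' suc k = x %ℕ suc k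

data XVal : Set where
  A AB B O : XVal

-- Standing data: prime p, f, the integer h, a representative γ' ∈ ℤ of the
-- class in ℤ/eℤ, and digits h_0,…,h_{f-1}.
module Setup (p f : ℕ) (h γ' : ℤ) (hs : Fin f → ℕ) where

  q : ℕ
  q = p ^ f

  e : ℕ
  e = q ∸ 1

  ν : ℕ
  ν = sum (map (λ j → p ^ suc j) (upTo (f ∸ 1)))

  hDigitValue : ℕ
  hDigitValue = 1 + sum (map (λ i → hs i * p ^ (f ∸ 1 ∸ toℕ i)) (allFin f))

  hExt : ℕ → ℕ
  hExt i with i mod' (2 * f)
  ... | j with j <? f
  ...   | yes j<f = hs (fromℕ< j<f)
  ...   | no _ with (j ∸ f) <? f
  ...     | yes k<f = (p ∸ 1) ∸ hs (fromℕ< k<f)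
  ...     | no _ = 0

  ε : ℕ → ℕ
  ε i with hExt i ≟ (p ∸ 1)
  ... | yes _ = 1
  ... | no _ = 0

  α : ℕ → ℕ
  α i = ((((+ (p ^ j)) ℤ.* h) /ℕ suc q) ℤ.- ((+ (p ^ j)) ℤ.* γ')) modℤ' e
    where
    j : ℕ
    j = i mod' (2 * f)

  α' : ℕ → ℕ
  α' i = ((+ ν) ℤ.- (+ α (i + f))) modℤ' e

  -- X_i (the rational bounds ν/p, (p-1)ν/p are cleared of denominators
  -- by multiplying through by p > 0):
  --   A  : α_i < ν/p + ε_{i+f}
  --   AB : ν/p + ε_{i+f} ≤ α_i ≤ (p-1)ν/p - ε_i
  --   B  : (p-1)ν/p - ε_i < α_i ≤ ν
  --   0  : ν < α_i < e
  X : ℕ → XVal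
  X i with p * α i <? ν + p * ε (i + f)
  ... | yes _ = A
  ... | no _ with p * α i + p * ε i ≤? (p ∸ 1) * ν
  ...   | yes _ = AB
  ...   | no _ with α i ≤? ν
  ...     | yes _ = B
  ...     | no _ = O

module Submission where

-- Both sides reduce to the single condition ν < α_j (with j = i resp. j = i+f):
--
--  * Right-hand side.  X_j = 0 is the last branch of the definition of X_j;
--    if ν < α_j, every earlier branch is impossible because p·α_j ≥ p·ν + p
--    exceeds both ν + p·ε and (p-1)·ν.  So X_j = 0 ⇔ ν < α_j.
--  * Left-hand side.  By 2f-periodicity α_{i+2f} = α_i, so in both parts the
--    sum has the shape a + ((ν - a) mod e) with a = α_j.  Since ν < e
--    (ν + p ≤ p^f, a geometric-sum estimate), this sum equals ν exactly when
--    a ≤ ν, and exceeds ν when a > ν.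

open import Defs
open import Data.Nat using (ℕ; suc; _≤_; _<_; _>_; _+_; _^_)
open import Data.Nat.Primality using (Prime)
open import Data.Integer using (ℤ; +_; _-_)
open import Data.Integer.Divisibility using (_∣_)
open import Data.Fin using (Fin)
open import Data.Product using (_×_)
open import Function.Bundles using (_⇔_)
open import Relation.Binary.PropositionalEquality using (_≡_)
open import Relation.Nullary using (¬_)

open import Data.Nat using (zero; _*_; _∸_; z≤n; s≤s; _<?_; _≤?_; _≟_; nonTrivial⇒n>1; >-nonZero)
open import Data.Nat.Properties
import Data.Nat.DivMod as ℕ
import Data.Integer.Properties as ℤ
import Data.Integer.DivMod as ℤ
open import Data.Nat.Primality using (prime)
open import Data.List using (applyUpTo; _∷ʳ_)
open import Data.List.Properties using (applyUpTo-∷ʳ; map-upTo)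
open import Data.Nat.ListAction using (sum)
open import Data.Nat.ListAction.Properties using (sum-++)
open import Data.Product using (_,_)
open import Function.Bundles using (mk⇔)
import Function.Properties.Equivalence as ⇔
open import Relation.Binary.PropositionalEquality using (refl; sym; trans; cong; module ≡-Reasoning)
open import Relation.Nullary using (yes; no; contradiction)

prime⇒2≤p : ∀ {p} → Prime p → 2 ≤ p
prime⇒2≤p {p} (prime _) = nonTrivial⇒n>1 p

-- A sequence that at least doubles at each step dominates the sum of all its
-- earlier terms plus its first term; this gives ν + p ≤ p^f.
doubling-sum : (g : ℕ → ℕ) → (∀ j → 2 * g j ≤ g (suc j)) →
               ∀ n → sum (applyUpTo g n) + g 0 ≤ g n
doubling-sum g doubling zero = ≤-refl
doubling-sum g doubling (suc n) = begin
  sum (applyUpTo g (suc n)) + g 0   ≡⟨ cong (λ xs → sum xs + g 0) (sym (applyUpTo-∷ʳ g n)) ⟩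
  sum (applyUpTo g n ∷ʳ g n) + g 0  ≡⟨ cong (_+ g 0) (sum-++ (applyUpTo g n) _) ⟩
  (S + (g n + 0)) + g 0             ≡⟨ cong (λ x → (S + x) + g 0) (+-identityʳ (g n)) ⟩
  (S + g n) + g 0                   ≡⟨ +-assoc S (g n) (g 0) ⟩
  S + (g n + g 0)                   ≡⟨ cong (λ x → S + x) (+-comm (g n) (g 0)) ⟩
  S + (g 0 + g n)                   ≡⟨ sym (+-assoc S (g 0) (g n)) ⟩
  (S + g 0) + g n                   ≤⟨ +-monoˡ-≤ (g n) (doubling-sum g doubling n) ⟩
  g n + g n                         ≡⟨ cong (λ x → g n + x) (sym (+-identityʳ (g n))) ⟩
  2 * g n                           ≤⟨ doubling n ⟩
  g (suc n)                         ∎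
  where
  open ≤-Reasoning
  S : ℕ
  S = sum (applyUpTo g n)

-- Adding the modulus does not change the (total) remainder; this is what
-- makes α, defined through i mod 2f, 2f-periodic.
mod'-period : ∀ n m → (m + n) mod' n ≡ m mod' n
mod'-period zero    m = refl
mod'-period (suc k) m = ℕ.[m+n]%n≡m%n m (suc k)

-- If a ≤ ν < e, the residue of ν - a modulo e is ν - a itself, so
-- a + ((ν - a) mod e) = ν.
complement-mod : ∀ e ν a → ν < e → a ≤ ν → a + ((+ ν) - (+ a)) modℤ' e ≡ ν
complement-mod (suc k) ν a ν<e a≤ν
  rewrite ℤ.[+m]-[+n]≡m⊖n ν a | ℤ.⊖-≥ a≤ν
        | ℕ.m<n⇒m%n≡m {m = ν ∸ a} (≤-<-trans (m∸n≤m ν a) ν<e)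
  = m+[n∸m]≡n a≤ν

complement-overshoot : ∀ e ν a → ν < e → (ν < a + ((+ ν) - (+ a)) modℤ' e) ⇔ (ν < a)
complement-overshoot e ν a ν<e = mk⇔ to from
  where
  to : ν < a + ((+ ν) - (+ a)) modℤ' e → ν < a
  to ν<sum with ν <? a
  ... | yes ν<a = ν<a
  ... | no ν≮a  = contradiction (complement-mod e ν a ν<e (≮⇒≥ ν≮a)) (>⇒≢ ν<sum)
  from : ν < a → ν < a + ((+ ν) - (+ a)) modℤ' e
  from ν<a = <-≤-trans ν<a (m≤m+n a _)

-- If ν < a then p·a ≥ p·ν + p; the two estimates below rule out the
-- branches A and AB of X once α_j > ν.
scaled-overshoot : ∀ p ν a → ν < a → p * ν + p ≤ p * a
scaled-overshoot p ν a ν<a = begin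
  p * ν + p   ≡⟨ +-comm (p * ν) p ⟩
  p + p * ν   ≡⟨ sym (*-suc p ν) ⟩
  p * suc ν   ≤⟨ *-monoʳ-≤ p ν<a ⟩
  p * a       ∎
  where open ≤-Reasoning

overshoot-excludes-A : ∀ p ν a c → 1 ≤ p → c ≤ 1 → ν < a → ν + p * c ≤ p * a
overshoot-excludes-A p ν a c 1≤p c≤1 ν<a = begin
  ν + p * c   ≤⟨ +-mono-≤ (m≤n*m ν p {{>-nonZero 1≤p}}) (*-monoʳ-≤ p c≤1) ⟩
  p * ν + p * 1 ≡⟨ cong (λ x → p * ν + x) (*-identityʳ p) ⟩
  p * ν + p   ≤⟨ scaled-overshoot p ν a ν<a ⟩
  p * a       ∎
  where open ≤-Reasoning

overshoot-excludes-AB : ∀ p ν a → 1 ≤ p → ν < a → (p ∸ 1) * ν < p * a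
overshoot-excludes-AB p ν a 1≤p ν<a = begin-strict
  (p ∸ 1) * ν ≤⟨ *-monoˡ-≤ ν (m∸n≤m p 1) ⟩
  p * ν       <⟨ m<m+n (p * ν) 1≤p ⟩
  p * ν + p   ≤⟨ scaled-overshoot p ν a ν<a ⟩
  p * a       ∎
  where open ≤-Reasoning

module Properties (p f : ℕ) (h γ' : ℤ) (hs : Fin f → ℕ) (2≤p : 2 ≤ p) (1≤f : 1 ≤ f) where
  open Setup p f h γ' hs

  1≤p : 1 ≤ p
  1≤p = ≤-trans (s≤s z≤n) 2≤p

  ε≤1 : ∀ j → ε j ≤ 1
  ε≤1 j with hExt j ≟ (p ∸ 1)
  ... | yes _ = s≤s z≤n
  ... | no _  = z≤n

  -- ν + p ≤ p^f: the powers p^(j+1) at least double at each step since p ≥ 2.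
  ν+p≤q : ν + p ≤ q
  ν+p≤q = begin
    ν + p                                              ≡⟨ cong (λ xs → sum xs + p) (map-upTo (λ j → p ^ suc j) (f ∸ 1)) ⟩
    sum (applyUpTo (λ j → p ^ suc j) (f ∸ 1)) + p      ≡⟨ cong (λ x → sum (applyUpTo (λ j → p ^ suc j) (f ∸ 1)) + x) (sym (*-identityʳ p)) ⟩
    sum (applyUpTo (λ j → p ^ suc j) (f ∸ 1)) + p ^ 1  ≤⟨ doubling-sum (λ j → p ^ suc j) (λ j → *-monoˡ-≤ (p ^ suc j) 2≤p) (f ∸ 1) ⟩
    p ^ suc (f ∸ 1)                                    ≡⟨ cong (p ^_) (trans (+-comm 1 (f ∸ 1)) (m∸n+n≡m 1≤f)) ⟩
    q                                                  ∎
    where open ≤-Reasoning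

  ν<e : ν < e
  ν<e = m+n≤o⇒m≤o∸n (suc ν) (begin
    suc ν + 1   ≡⟨ sym (+-suc ν 1) ⟩
    ν + 2       ≤⟨ +-monoʳ-≤ ν 2≤p ⟩
    ν + p       ≤⟨ ν+p≤q ⟩
    q           ∎)
    where open ≤-Reasoning

  α-periodic : ∀ i → α (i + f + f) ≡ α i
  α-periodic i = α-residue (i + f + f) i (begin
    (i + f + f) mod' (2 * f)   ≡⟨ cong (_mod' (2 * f)) (trans (+-assoc i f f) (cong (λ x → i + (f + x)) (sym (+-identityʳ f)))) ⟩
    (i + 2 * f) mod' (2 * f)   ≡⟨ mod'-period (2 * f) i ⟩
    i mod' (2 * f)             ∎)
    where
    open ≡-Reasoning
    α-residue : ∀ m n → m mod' (2 * f) ≡ n mod' (2 * f) → α m ≡ α n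
    α-residue m n same-residue rewrite same-residue = refl

  X≡O⇔ν<α : ∀ j → (X j ≡ O) ⇔ (ν < α j)
  X≡O⇔ν<α j with p * α j <? ν + p * ε (j + f)
  ... | yes inA = mk⇔ (λ ()) (λ ν<α → contradiction inA
                        (≤⇒≯ (overshoot-excludes-A p ν (α j) (ε (j + f)) 1≤p (ε≤1 (j + f)) ν<α)))
  ... | no _ with p * α j + p * ε j ≤? (p ∸ 1) * ν
  ...   | yes inAB = mk⇔ (λ ()) (λ ν<α → contradiction
                        (≤-trans (m≤m+n (p * α j) (p * ε j)) inAB)
                        (<⇒≱ (overshoot-excludes-AB p ν (α j) 1≤p ν<α)))
  ...   | no _ with α j ≤? ν
  ...     | yes α≤ν = mk⇔ (λ ()) (λ ν<α → contradiction α≤ν (<⇒≱ ν<α))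
  ...     | no α≰ν  = mk⇔ (λ _ → ≰⇒> α≰ν) (λ _ → refl)

  -- Part (i): by periodicity α'_{i+f} = (ν - α_i) mod e.
  overshoot-i : ∀ i → (α i + α' (i + f) > ν) ⇔ (X i ≡ O)
  overshoot-i i rewrite α-periodic i =
    ⇔.trans (complement-overshoot e ν (α i) ν<e) (⇔.sym (X≡O⇔ν<α i))

  overshoot-ii : ∀ i → (α' i + α (i + f) > ν) ⇔ (X (i + f) ≡ O)
  overshoot-ii i rewrite +-comm (α' i) (α (i + f)) =
    ⇔.trans (complement-overshoot e ν (α (i + f)) ν<e) (⇔.sym (X≡O⇔ν<α (i + f)))

lemma3p3p1 : (p f : ℕ) → Prime p → 2 ≤ f →
    (h : ℤ) → ¬ (+ suc (p ^ f) ∣ h) →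
    (γ' : ℤ) →
    (hs : Fin f → ℕ) → (∀ i → hs i < p) →
    (+ suc (p ^ f) ∣ (h - + Setup.hDigitValue p f h γ' hs)) →
    (i : ℕ) → i < f →
    ((Setup.α p f h γ' hs i + Setup.α' p f h γ' hs (i + f) > Setup.ν p f h γ' hs)
    ⇔ (Setup.X p f h γ' hs i ≡ O))
    × ((Setup.α' p f h γ' hs i + Setup.α p f h γ' hs (i + f) > Setup.ν p f h γ' hs)
    ⇔ (Setup.X p f h γ' hs (i + f) ≡ O))
lemma3p3p1 p f p-prime 2≤f h _ γ' hs _ _ i _ = overshoot-i i , overshoot-ii i
  where open Properties p f h γ' hs (prime⇒2≤p p-prime) (≤-trans (s≤s z≤n) 2≤f)
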